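{- Let $\mathcal{S}$, $\mathcal{Y}\subseteq\mathcal{S}$, $\mathcal{M}_2$, $\mathcal{MM}_2$ and the map $\phi$ be as described in the context, and let $f:\mathcal{MM}_2\to\mathcal{M}_2$ be the map which forgets the marking. The image of $\mathcal{Y}$ under $f\circ\phi$ is exactly the set of bicoloured Motzkin paths all of whose steps are red. Consequently $f\circ\phi$ gives a length-preserving bijection between $\mathcal{Y}$ and the class $\mathcal{M}$ of (uncoloured) Motzkin paths.
   Context: A quarter plane walk is a finite walk in $\mathbb{Z}^2$ starting at $(0,0)$, staying in $\{(i,j): i\ge 0, j\ge 0\}$, using steps from a given set; its length is its number of steps. $\mathcal{S}$ is the class of quarter plane walks with steps from $\{(1,0),(1,-1),(0,-1),(-1,0),(-1,1),(0,1)\}$, written $\rightarrow,\searrow,\downarrow,\leftarrow,\nwarrow,\uparrow$ respectively, and $\mathcal{Y}$ is the class of quarter plane walks with steps from $\{(1,-1),(-1,0),(0,1)\}=\{\searrow,\leftarrow,\uparrow\}$. A Motzkin path is a walk from $(0,0)$ using the steps $\nearrow=(1,1)$, $\rightarrow=(1,0)$, $\searrow=(1,-1)$, never going below the $x$-axis and ending on the $x$-axis; $\mathcal{M}$ is the class of Motzkin paths. $\mathcal{M}_2$ is the class of bicoloured Motzkin paths (each step coloured red or black); $\mathcal{MM}_2$ is the class of bicoloured Motzkin paths in which each step is additionally either marked or unmarked. The map $\phi$: given $w\in\mathcal{S}$, start with the empty path $m$ and read the steps of $w$ from first to last, modifying $m$ as follows. (1) Step $\uparrow$: append a marked red $\rightarrow$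 to $m$. (2) Step $\rightarrow$: append a marked black $\rightarrow$ to $m$. (3) Step $\searrow$: find the rightmost step of $m$ that is either a marked red $\rightarrow$ or a marked black $\searrow$; if it is a marked red $\rightarrow$ replace it by an unmarked red $\nearrow$, if it is a marked black $\searrow$ replace it by an unmarked black $\rightarrow$. Then append a marked red $\searrow$. (4) Step $\nwarrow$: find the rightmost step of $m$ that is either a marked black $\rightarrow$ or a marked red $\searrow$; if it is a marked black $\rightarrow$ replace it by an unmarked black $\nearrow$, if it is a marked red $\searrow$ replace it by an unmarked red $\rightarrow$. Then append a marked black $\searrow$. (5) Step $\leftarrow$: perform the same search and replacement as in (4), then append an unmarked red $\searrow$. (6) Step $\downarrow$: perform the same search and replacement as in (3), then append an unmarked black $\searrow$. The final $m$ is $\phi(w)$. -}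

module Defs where

open import Data.Nat using (ℕ; zero; suc)
open import Data.Bool using (Bool; true; false; if_then_else_)
open import Data.List using (List; []; _∷_; reverse; map; length)
open import Data.List.Relation.Unary.All using (All)
open import Relation.Binary.PropositionalEquality using (_≡_)

data Step : Set where
  E SE S W NW N : Step
-- E = (1,0), SE = (1,-1), S = (0,-1), W = (-1,0), NW = (-1,1), N = (0,1)

-- QP i j w : the walk w, started at (i , j), never leaves the quarter plane
-- (coordinates are naturals, so a step decreasing a coordinate requires it
-- to be positive).
data QP : ℕ → ℕ → List Step → Set where
  done   : ∀ {i j} → QP i j []
  stepE  : ∀ {i j w} → QP (suc i) j w → QP i j (E ∷ w)
  stepSE : ∀ {i j w} → QP (suc i) j w → QP i (suc j) (SE ∷ w)
  stepS  : ∀ {i j w} → QP i j w → QP i (suc j) (S ∷ w)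
  stepW  : ∀ {i j w} → QP i j w → QP (suc i) j (W ∷ w)
  stepNW : ∀ {i j w} → QP i (suc j) w → QP (suc i) j (NW ∷ w)
  stepN  : ∀ {i j w} → QP i (suc j) w → QP i j (N ∷ w)

InS : List Step → Set
InS w = QP 0 0 w

data YStep : Step → Set where
  ySE : YStep SE
  yW  : YStep W
  yN  : YStep N

InY : List Step → Set
InY w = InS w × All YStep w
  where open import Data.Product using (_×_)

data MStep : Set where
  U F D : MStep

data Mot : ℕ → List MStep → Set where
  nil  : Mot 0 []
  up   : ∀ {h p} → Mot (suc h) p → Mot h (U ∷ p)
  flat : ∀ {h p} → Mot h p → Mot h (F ∷ p)
  down : ∀ {h p} → Mot h p → Mot (suc h) (D ∷ p)

IsMotzkin : List MStep → Set
IsMotzkin p = Mot 0 p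

data Colour : Set where
  red black : Colour

-- a step of a bicoloured Motzkin path (element of 𝓜₂ when the underlying
-- list of directions is Motzkin)
record CStep : Set where
  constructor cstep
  field
    colour : Colour
    dir    : MStep
open CStep public

record MCStep : Set where
  constructor mcstep
  field
    mcolour : Colour
    mdir    : MStep
    marked  : Bool
open MCStep public

IsRed : CStep → Set
IsRed s = colour s ≡ red

-- The map φ.  The path m is kept in reverse order (head = rightmost step).

-- Search for the rightmost step of m (reversed) matching one of two kinds,
-- and replace it.  kind A: marked red → ↦ unmarked red ↗,
--                           marked black ↘ ↦ unmarked black →   (rule (3))
-- kind B: marked black → ↦ unmarked black ↗,
--         marked red ↘ ↦ unmarked red →                          (rule (4))
-- If no such step exists, m is left unchanged (this never happens for
-- walks in 𝒮).

replaceA : List MCStep → List MCStep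
replaceA [] = []
replaceA (mcstep red F true ∷ m)   = mcstep red U false ∷ m
replaceA (mcstep black D true ∷ m) = mcstep black F false ∷ m
replaceA (s ∷ m) = s ∷ replaceA m

replaceB : List MCStep → List MCStep
replaceB [] = []
replaceB (mcstep black F true ∷ m) = mcstep black U false ∷ m
replaceB (mcstep red D true ∷ m)   = mcstep red F false ∷ m
replaceB (s ∷ m) = s ∷ replaceB m

φstep : List MCStep → Step → List MCStep
φstep m N  = mcstep red F true ∷ m
φstep m E  = mcstep black F true ∷ m
φstep m SE = mcstep red D true ∷ replaceA m
φstep m NW = mcstep black D true ∷ replaceB m
φstep m W  = mcstep red D false ∷ replaceB m
φstep m S  = mcstep black D false ∷ replaceA m

φrev : List MCStep → List Step → List MCStep
φrev m [] = m
φrev m (s ∷ w) = φrev (φstep m s) w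

φ : List Step → List MCStep
φ w = reverse (φrev [] w)

forget : MCStep → CStep
forget (mcstep c d _) = cstep c d

f : List MCStep → List CStep
f = map forget

fφ : List Step → List CStep
fφ w = f (φ w)

-- Along a walk of 𝒴 only rules (1), (3) and (5) fire, and they only create red steps.  Every
-- step of φ(w) keeps track of the step of w that appended it (the replacements in rules (3)–(6)
-- preserve this), so w can be read back from the marked path.  For w ∈ 𝒴 the marked paths that
-- occur are exactly the red Motzkin paths marked by a two-counter automaton running over the
-- directions, so the marking, and hence w, is determined by the uncoloured Motzkin path; and
-- replaying the walk read off any such path rebuilds that path.
module Submission where

open import Defs
open import Data.List using (List; map; length)
open import Data.List.Relation.Unary.All using (All)
open import Data.Product using (_×_; ∃-syntax)
open import Relation.Binary.PropositionalEquality using (_≡_)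

open import Data.Nat using (ℕ; zero; suc; _+_; _<_; s≤s; z≤n)
open import Data.Nat.Properties using (+-suc; suc-injective)
open import Data.Bool using (true; false)
open import Data.List using ([]; _∷_; _ʳ++_; reverse; _∷ʳ_)
open import Data.List.Properties
  using (unfold-reverse; reverse-involutive; reverse-map; length-map; length-reverse; map-∘; map-id)
open import Data.List.Relation.Unary.All using ([]; _∷_; universal)
open import Data.List.Relation.Unary.All.Properties using (map⁺)
open import Data.Product using (_,_; ∃; ∃₂)
open import Function using (_∘_)
open import Relation.Binary.PropositionalEquality
  using (refl; sym; trans; cong; subst; module ≡-Reasoning)

private variable
  p q i j : ℕ
  m : List MCStep

pattern U○ = mcstep red U false
pattern F○ = mcstep red F false
pattern F● = mcstep red F true
pattern D○ = mcstep red D false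
pattern D● = mcstep red D true

All-reverse⁺ : ∀ {A : Set} {P : A → Set} {xs : List A} → All P xs → All P (reverse xs)
All-reverse⁺ {xs = xs} pxs = All-ʳ++⁺ xs pxs []
  where
  All-ʳ++⁺ : ∀ {A : Set} {P : A → Set} xs {ys : List A} → All P xs → All P ys → All P (xs ʳ++ ys)
  All-ʳ++⁺ []       []         pys = pys
  All-ʳ++⁺ (x ∷ xs) (px ∷ pxs) pys = All-ʳ++⁺ xs pxs (px ∷ pys)

-- The step of the walk that appended this step of the marked path.
origin : MCStep → Step
origin (mcstep red   U _)     = N
origin (mcstep black U _)     = E
origin (mcstep red   F true)  = N
origin (mcstep black F true)  = E
origin (mcstep red   F false) = SE
origin (mcstep black F false) = NW
origin (mcstep red   D true)  = SE
origin (mcstep black D true)  = NW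
origin (mcstep red   D false) = W
origin (mcstep black D false) = S

walk : List MCStep → List Step
walk m = reverse (map origin m)

origins-replaceA : ∀ m → map origin (replaceA m) ≡ map origin m
origins-replaceA [] = refl
origins-replaceA (mcstep red   F true  ∷ m) = refl
origins-replaceA (mcstep black D true  ∷ m) = refl
origins-replaceA (s@(mcstep red   U _)     ∷ m) = cong (origin s ∷_) (origins-replaceA m)
origins-replaceA (s@(mcstep red   F false) ∷ m) = cong (origin s ∷_) (origins-replaceA m)
origins-replaceA (s@(mcstep red   D true)  ∷ m) = cong (origin s ∷_) (origins-replaceA m)
origins-replaceA (s@(mcstep red   D false) ∷ m) = cong (origin s ∷_) (origins-replaceA m)
origins-replaceA (s@(mcstep black U _)     ∷ m) = cong (origin s ∷_) (origins-replaceA m)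
origins-replaceA (s@(mcstep black F true)  ∷ m) = cong (origin s ∷_) (origins-replaceA m)
origins-replaceA (s@(mcstep black F false) ∷ m) = cong (origin s ∷_) (origins-replaceA m)
origins-replaceA (s@(mcstep black D false) ∷ m) = cong (origin s ∷_) (origins-replaceA m)

origins-replaceB : ∀ m → map origin (replaceB m) ≡ map origin m
origins-replaceB [] = refl
origins-replaceB (mcstep black F true  ∷ m) = refl
origins-replaceB (mcstep red   D true  ∷ m) = refl
origins-replaceB (s@(mcstep red   U _)     ∷ m) = cong (origin s ∷_) (origins-replaceB m)
origins-replaceB (s@(mcstep red   F true)  ∷ m) = cong (origin s ∷_) (origins-replaceB m)
origins-replaceB (s@(mcstep red   F false) ∷ m) = cong (origin s ∷_) (origins-replaceB m)
origins-replaceB (s@(mcstep red   D false) ∷ m) = cong (origin s ∷_) (origins-replaceB m)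
origins-replaceB (s@(mcstep black U _)     ∷ m) = cong (origin s ∷_) (origins-replaceB m)
origins-replaceB (s@(mcstep black F false) ∷ m) = cong (origin s ∷_) (origins-replaceB m)
origins-replaceB (s@(mcstep black D true)  ∷ m) = cong (origin s ∷_) (origins-replaceB m)
origins-replaceB (s@(mcstep black D false) ∷ m) = cong (origin s ∷_) (origins-replaceB m)

origins-φstep : ∀ m s → map origin (φstep m s) ≡ s ∷ map origin m
origins-φstep m N  = refl
origins-φstep m E  = refl
origins-φstep m SE = cong (SE ∷_) (origins-replaceA m)
origins-φstep m NW = cong (NW ∷_) (origins-replaceB m)
origins-φstep m W  = cong (W ∷_)  (origins-replaceB m)
origins-φstep m S  = cong (S ∷_)  (origins-replaceA m)

origins-φrev : ∀ m w → map origin (φrev m w) ≡ w ʳ++ map origin m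
origins-φrev m []      = refl
origins-φrev m (s ∷ w) = trans (origins-φrev (φstep m s) w) (cong (w ʳ++_) (origins-φstep m s))

walk-φrev : ∀ w → walk (φrev [] w) ≡ w
walk-φrev w = trans (cong reverse (origins-φrev [] w)) (reverse-involutive w)

length-fφ : ∀ w → length (fφ w) ≡ length w
length-fφ w = begin
  length (f (reverse φw))   ≡⟨ length-map forget (reverse φw) ⟩
  length (reverse φw)       ≡⟨ length-reverse φw ⟩
  length φw                 ≡⟨ sym (length-map origin φw) ⟩
  length (map origin φw)    ≡⟨ sym (length-reverse (map origin φw)) ⟩
  length (walk φw)          ≡⟨ cong length (walk-φrev w) ⟩
  length w                  ∎
  where open ≡-Reasoning
        φw = φrev [] w

-- Shape p q i j m : m (reversed, head = rightmost step) is a red path such that, at its right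
-- end, p steps ↗ still wait for their partner (the marked ↘ appended together with the ↗,
-- possibly turned into an unmarked → since), q unmarked → still wait for their partner (the
-- unmarked ↘ appended with it), and i and j steps ↘ resp. → are marked.  Hence the height is
-- p + q, and if m = φrev [] w then w ends at (i , j).
data Shape : ℕ → ℕ → ℕ → ℕ → List MCStep → Set where
  []  : Shape 0 0 0 0 []
  u○  : Shape p q i j m → Shape (suc p) q i j (U○ ∷ m)
  f○  : Shape (suc p) q i j m → Shape p (suc q) i j (F○ ∷ m)
  f●  : Shape 0 q i j m → Shape 0 q i (suc j) (F● ∷ m)
  d○  : Shape p (suc q) i j m → Shape p q i j (D○ ∷ m)
  d●  : Shape (suc p) 0 i j m → Shape p 0 (suc i) j (D● ∷ m)

shape-replaceA : Shape p q i (suc j) m → Shape (suc p) q i j (replaceA m)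
shape-replaceA (u○ g) = u○ (shape-replaceA g)
shape-replaceA (f○ g) = f○ (shape-replaceA g)
shape-replaceA (f● g) = u○ g
shape-replaceA (d○ g) = d○ (shape-replaceA g)
shape-replaceA (d● g) = d● (shape-replaceA g)

shape-replaceB : Shape p q (suc i) j m → Shape p (suc q) i j (replaceB m)
shape-replaceB (u○ g) = u○ (shape-replaceB g)
shape-replaceB (f○ g) = f○ (shape-replaceB g)
shape-replaceB (f● g) = f● (shape-replaceB g)
shape-replaceB (d○ g) = d○ (shape-replaceB g)
shape-replaceB (d● g) = f○ g

shape-φrev : ∀ {w} → QP i j w → All YStep w → Shape 0 0 i j m →
             ∃₂ λ i′ j′ → Shape 0 0 i′ j′ (φrev m w)
shape-φrev done        []         g = _ , _ , g
shape-φrev (stepSE qp) (ySE ∷ ys) g = shape-φrev qp ys (d● (shape-replaceA g))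
shape-φrev (stepW qp)  (yW ∷ ys)  g = shape-φrev qp ys (d○ (shape-replaceB g))
shape-φrev (stepN qp)  (yN ∷ ys)  g = shape-φrev qp ys (f● g)

shape-φ : ∀ {w} → InY w → ∃₂ λ i′ j′ → Shape 0 0 i′ j′ (φrev [] w)
shape-φ (qp , ys) = shape-φrev qp ys []

shape⇒motzkin : Shape p q i j m → ∀ {s} → Mot (p + q) s → IsMotzkin (map dir (f m) ʳ++ s)
shape⇒motzkin []     h = h
shape⇒motzkin (u○ g) h = shape⇒motzkin g (up h)
shape⇒motzkin (f○ {p} {q} g) {s} h =
  shape⇒motzkin g (flat (subst (λ k → Mot k s) (+-suc p q) h))
shape⇒motzkin (f● g) h = shape⇒motzkin g (flat h)
shape⇒motzkin (d○ {p} {q} g) {s} h =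
  shape⇒motzkin g (subst (λ k → Mot k (D ∷ s)) (sym (+-suc p q)) (down h))
shape⇒motzkin (d● g) h = shape⇒motzkin g (down h)

shape⇒red : Shape p q i j m → All IsRed (f m)
shape⇒red []     = []
shape⇒red (u○ g) = refl ∷ shape⇒red g
shape⇒red (f○ g) = refl ∷ shape⇒red g
shape⇒red (f● g) = refl ∷ shape⇒red g
shape⇒red (d○ g) = refl ∷ shape⇒red g
shape⇒red (d● g) = refl ∷ shape⇒red g

directions-fφ : ∀ w → map dir (fφ w) ≡ reverse (map dir (f (φrev [] w)))
directions-fφ w =
  trans (cong (map dir) (reverse-map forget (φrev [] w))) (reverse-map dir (f (φrev [] w)))

fφ-motzkin : ∀ {w} → InY w → IsMotzkin (map dir (fφ w))
fφ-motzkin {w} y with _ , _ , g ← shape-φ y =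
  subst IsMotzkin (sym (directions-fφ w)) (shape⇒motzkin g nil)

fφ-red : ∀ {w} → InY w → All IsRed (fφ w)
fφ-red {w} y with _ , _ , g ← shape-φ y =
  subst (All IsRed) (sym (reverse-map forget (φrev [] w))) (All-reverse⁺ (shape⇒red g))

-- The counters are those of Shape: a → is marked iff p = 0, and a ↘ is unmarked iff q > 0.
-- The last clause, a ↘ at height 0, never fires on a Motzkin path.
decode : ℕ → ℕ → List MStep → List Step
decode p       q       []      = []
decode p       q       (U ∷ l) = N ∷ decode (suc p) q l
decode zero    q       (F ∷ l) = N ∷ decode zero q l
decode (suc p) q       (F ∷ l) = SE ∷ decode p (suc q) l
decode p       (suc q) (D ∷ l) = W ∷ decode p q l
decode (suc p) zero    (D ∷ l) = SE ∷ decode p zero l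
decode zero    zero    (D ∷ l) = []

decode-shape : Shape p q i j m → ∀ s →
               decode 0 0 (map dir (f m) ʳ++ s) ≡ map origin m ʳ++ decode p q s
decode-shape []     s = refl
decode-shape (u○ g) s = decode-shape g (U ∷ s)
decode-shape (f○ g) s = decode-shape g (F ∷ s)
decode-shape (f● g) s = decode-shape g (F ∷ s)
decode-shape (d○ g) s = decode-shape g (D ∷ s)
decode-shape (d● g) s = decode-shape g (D ∷ s)

decode-fφ : ∀ {w} → InY w → decode 0 0 (map dir (fφ w)) ≡ w
decode-fφ {w} y with _ , _ , g ← shape-φ y = begin
  decode 0 0 (map dir (fφ w))                      ≡⟨ cong (decode 0 0) (directions-fφ w) ⟩
  decode 0 0 (reverse (map dir (f (φrev [] w))))   ≡⟨ decode-shape g [] ⟩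
  walk (φrev [] w)                                 ≡⟨ walk-φrev w ⟩
  w                                                ∎
  where open ≡-Reasoning

redMotzkin⇒shape : ∀ {p q i j m} l → All IsRed l → ∀ {h} → Mot h (map dir l) → h ≡ p + q →
                   Shape p q i j m → ∃₂ λ i′ j′ → ∃ λ m′ → Shape 0 0 i′ j′ m′ × f m′ ≡ l ʳ++ f m
redMotzkin⇒shape {zero}  {zero}  [] [] nil refl g = _ , _ , _ , g , refl
redMotzkin⇒shape {zero}  {suc q} [] [] nil ()   g
redMotzkin⇒shape {suc p}         [] [] nil ()   g
redMotzkin⇒shape (cstep .red U ∷ l) (refl ∷ rs) (up h) e g =
  redMotzkin⇒shape l rs h (cong suc e) (u○ g)
redMotzkin⇒shape {zero}         (cstep .red F ∷ l) (refl ∷ rs) (flat h) e g =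
  redMotzkin⇒shape l rs h e (f● g)
redMotzkin⇒shape {suc p} {q}    (cstep .red F ∷ l) (refl ∷ rs) (flat h) e g =
  redMotzkin⇒shape l rs h (trans e (sym (+-suc p q))) (f○ g)
redMotzkin⇒shape {p} {suc q}    (cstep .red D ∷ l) (refl ∷ rs) (down h) e g =
  redMotzkin⇒shape l rs h (suc-injective (trans e (+-suc p q))) (d○ g)
redMotzkin⇒shape {suc p} {zero} (cstep .red D ∷ l) (refl ∷ rs) (down h) e g =
  redMotzkin⇒shape l rs h (suc-injective e) (d● g)
redMotzkin⇒shape {zero} {zero}  (cstep .red D ∷ l) (refl ∷ rs) (down h) () g

shape⇒quarterPlane : Shape p q i j m → ∀ {s} → QP (q + i) (p + j) s → InS (map origin m ʳ++ s)
shape⇒quarterPlane []     qp = qp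
shape⇒quarterPlane (u○ g) qp = shape⇒quarterPlane g (stepN qp)
shape⇒quarterPlane (f○ g) qp = shape⇒quarterPlane g (stepSE qp)
shape⇒quarterPlane (f● g) qp = shape⇒quarterPlane g (stepN qp)
shape⇒quarterPlane (d○ g) qp = shape⇒quarterPlane g (stepW qp)
shape⇒quarterPlane (d● g) qp = shape⇒quarterPlane g (stepSE qp)

shape⇒ysteps : Shape p q i j m → All YStep (map origin m)
shape⇒ysteps []     = []
shape⇒ysteps (u○ g) = yN ∷ shape⇒ysteps g
shape⇒ysteps (f○ g) = ySE ∷ shape⇒ysteps g
shape⇒ysteps (f● g) = yN ∷ shape⇒ysteps g
shape⇒ysteps (d○ g) = yW ∷ shape⇒ysteps g
shape⇒ysteps (d● g) = ySE ∷ shape⇒ysteps g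

-- Run on the walk of a prefix, φ leaves each ↗ whose partner lies beyond the prefix as a marked →,
-- and each unmarked → whose partner is missing as a marked ↘.  reopen m c d produces this state,
-- c and d being the numbers of partners of ↗ resp. of unmarked → available to the right of m.
reopen : List MCStep → ℕ → ℕ → List MCStep
reopen []       c       d       = []
reopen (U○ ∷ m) (suc c) d       = U○ ∷ reopen m c d
reopen (U○ ∷ m) zero    d       = F● ∷ reopen m zero d
reopen (F○ ∷ m) c       (suc d) = F○ ∷ reopen m (suc c) d
reopen (F○ ∷ m) c       zero    = D● ∷ reopen m (suc c) zero
reopen (D● ∷ m) c       d       = D● ∷ reopen m (suc c) d
reopen (D○ ∷ m) c       d       = D○ ∷ reopen m c (suc d)
reopen (s ∷ m)  c       d       = s ∷ reopen m c d

replaceA-reopen : Shape p q i j m → ∀ c d → c < p → replaceA (reopen m c d) ≡ reopen m (suc c) d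
replaceA-reopen (u○ g) (suc c) d (s≤s c<p) = cong (U○ ∷_) (replaceA-reopen g c d c<p)
replaceA-reopen (u○ g) zero    d _         = refl
replaceA-reopen (f○ g) c (suc d) c<p = cong (F○ ∷_) (replaceA-reopen g (suc c) d (s≤s c<p))
replaceA-reopen (f○ g) c zero    c<p = cong (D● ∷_) (replaceA-reopen g (suc c) zero (s≤s c<p))
replaceA-reopen (d○ g) c d       c<p = cong (D○ ∷_) (replaceA-reopen g c (suc d) c<p)
replaceA-reopen (d● g) c d       c<p = cong (D● ∷_) (replaceA-reopen g (suc c) d (s≤s c<p))

replaceB-reopen : Shape p q i j m → ∀ c d → d < q → replaceB (reopen m c d) ≡ reopen m c (suc d)
replaceB-reopen (u○ g) (suc c) d d<q = cong (U○ ∷_) (replaceB-reopen g c d d<q)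
replaceB-reopen (u○ g) zero    d d<q = cong (F● ∷_) (replaceB-reopen g zero d d<q)
replaceB-reopen (f○ g) c (suc d) (s≤s d<q) = cong (F○ ∷_) (replaceB-reopen g (suc c) d d<q)
replaceB-reopen (f○ g) c zero    _         = refl
replaceB-reopen (f● g) c d       d<q = cong (F● ∷_) (replaceB-reopen g c d d<q)
replaceB-reopen (d○ g) c d       d<q = cong (D○ ∷_) (replaceB-reopen g c (suc d) (s≤s d<q))

reopen-closed : Shape p q i j m → reopen m p q ≡ m
reopen-closed []     = refl
reopen-closed (u○ g) = cong (U○ ∷_) (reopen-closed g)
reopen-closed (f○ g) = cong (F○ ∷_) (reopen-closed g)
reopen-closed (f● g) = cong (F● ∷_) (reopen-closed g)
reopen-closed (d○ g) = cong (D○ ∷_) (reopen-closed g)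
reopen-closed (d● g) = cong (D● ∷_) (reopen-closed g)

φrev-∷ʳ : ∀ m w s → φrev m (w ∷ʳ s) ≡ φstep (φrev m w) s
φrev-∷ʳ m []      s = refl
φrev-∷ʳ m (t ∷ w) s = φrev-∷ʳ (φstep m t) w s

φrev-walk-∷ : ∀ s m → φrev [] (walk (s ∷ m)) ≡ φstep (φrev [] (walk m)) (origin s)
φrev-walk-∷ s m = trans (cong (φrev []) (unfold-reverse (origin s) (map origin m)))
                        (φrev-∷ʳ [] (walk m) (origin s))

φrev-walk : Shape p q i j m → φrev [] (walk m) ≡ reopen m 0 0
φrev-walk []     = refl
φrev-walk {m = s ∷ m} (u○ g) =
  trans (φrev-walk-∷ s m) (cong (λ r → φstep r N) (φrev-walk g))
φrev-walk {m = s ∷ m} (f● g) =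
  trans (φrev-walk-∷ s m) (cong (λ r → φstep r N) (φrev-walk g))
φrev-walk {m = s ∷ m} (f○ g) = trans (φrev-walk-∷ s m)
  (cong (D● ∷_) (trans (cong replaceA (φrev-walk g)) (replaceA-reopen g 0 0 (s≤s z≤n))))
φrev-walk {m = s ∷ m} (d● g) = trans (φrev-walk-∷ s m)
  (cong (D● ∷_) (trans (cong replaceA (φrev-walk g)) (replaceA-reopen g 0 0 (s≤s z≤n))))
φrev-walk {m = s ∷ m} (d○ g) = trans (φrev-walk-∷ s m)
  (cong (D○ ∷_) (trans (cong replaceB (φrev-walk g)) (replaceB-reopen g 0 0 (s≤s z≤n))))

φrev-walk-closed : Shape 0 0 i j m → φrev [] (walk m) ≡ m
φrev-walk-closed g = trans (φrev-walk g) (reopen-closed g)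

fφ-onto-red : (p : List CStep) → IsMotzkin (map dir p) → All IsRed p → ∃[ w ] (InY w × fφ w ≡ p)
fφ-onto-red p h rs with _ , _ , m , g , fm≡p ← redMotzkin⇒shape p rs h refl [] =
  walk m , (shape⇒quarterPlane g done , All-reverse⁺ (shape⇒ysteps g)) , (begin
    f (reverse (φrev [] (walk m)))  ≡⟨ cong (f ∘ reverse) (φrev-walk-closed g) ⟩
    f (reverse m)                   ≡⟨ reverse-map forget m ⟩
    reverse (f m)                   ≡⟨ cong reverse fm≡p ⟩
    reverse (reverse p)             ≡⟨ reverse-involutive p ⟩
    p                               ∎)
  where open ≡-Reasoning

fφ-onto-motzkin : (q : List MStep) → IsMotzkin q → ∃[ w ] (InY w × map dir (fφ w) ≡ q)
fφ-onto-motzkin q h =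
  let w , y , fφw≡red = fφ-onto-red (map (cstep red) q) (subst IsMotzkin (sym dirs≡q) h) reds
  in  w , y , trans (cong (map dir) fφw≡red) dirs≡q
  where
  dirs≡q : map dir (map (cstep red) q) ≡ q
  dirs≡q = trans (sym (map-∘ q)) (map-id q)
  reds : All IsRed (map (cstep red) q)
  reds = map⁺ (universal (λ _ → refl) q)

mainTheorem2 :
  ((w : List Step) → InY w → IsMotzkin (map dir (fφ w)) × All IsRed (fφ w))
  × ((p : List CStep) → IsMotzkin (map dir p) → All IsRed p →
       ∃[ w ] (InY w × fφ w ≡ p))
  × ((w w′ : List Step) → InY w → InY w′ → map dir (fφ w) ≡ map dir (fφ w′) → w ≡ w′)
  × ((q : List MStep) → IsMotzkin q → ∃[ w ] (InY w × map dir (fφ w) ≡ q))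
  × ((w : List Step) → InY w → length (fφ w) ≡ length w)
mainTheorem2 =
    (λ w y → fφ-motzkin y , fφ-red y)
  , fφ-onto-red
  , (λ w w′ y y′ eq → trans (sym (decode-fφ y)) (trans (cong (decode 0 0) eq) (decode-fφ y′)))
  , fφ-onto-motzkin
  , (λ w _ → length-fφ w)
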